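{- Let $\tau$ be a $\gamma$-connected permutation in $\mathcal{S}^B_{nc}(p,q)$. Then $\tau$ has no inversion-invariant orbits (no orbit $A$ with $A=-A$).
   Context: $p,q\ge1$, $n=p+q$, $X=\{\pm1,\dots,\pm n\}$, $\gamma=(1,\dots,p,-1,\dots,-p)(p+1,\dots,n,-(p+1),\dots,-n)$, $Y=\{\pm1,\dots,\pm p\}$, $Z=\{\pm(p+1),\dots,\pm n\}$. $B_n$: permutations $\tau$ of $X$ with $\tau(-i)=-\tau(i)$. $\#(\sigma)$ is the number of orbits of $\sigma$, $\#(\tau,\gamma)$ the number of orbits of the group generated by $\tau,\gamma$; $\mathcal{S}_{nc}(X,\gamma)=\{\tau\mid \#(\tau)+\#(\tau^{ -1}\gamma)+\#(\gamma)=|X|+2\#(\tau,\gamma)\}$; $\mathcal{S}^B_{nc}(p,q)=\mathcal{S}_{nc}(X,\gamma)\cap B_n$. $\tau$ is $\gamma$-connected if some orbit of $\tau$ meets both $Y$ and $Z$. -}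

module Defs where

open import Data.Nat using (ℕ; zero; suc; _+_; _*_)
open import Data.Nat.Properties using (_≟_)
open import Data.Fin using (Fin; zero; suc; toℕ; lower₁; splitAt; _↑ˡ_; _↑ʳ_)
open import Data.Bool using (Bool; true; false; not)
open import Data.Product using (Σ; ∃; _×_; _,_; proj₁; proj₂)
open import Data.Sum using (_⊎_; inj₁; inj₂)
open import Relation.Nullary using (¬_; yes; no)
open import Relation.Binary.PropositionalEquality using (_≡_)
open import Function.Bundles using (_⇔_)

-- The signed set X = {±1,…,±n} with n = p + q.
-- An element (i , s) with i : Fin n stands for  +(toℕ i + 1)  if s = true
-- and  -(toℕ i + 1)  if s = false.
SignedSet : ℕ → Set
SignedSet n = Fin n × Bool

neg : ∀ {n} → SignedSet n → SignedSet n
neg (i , s) = i , not s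

record Perm (A : Set) : Set where
  field
    fun    : A → A
    inv    : A → A
    inv-l  : ∀ x → inv (fun x) ≡ x
    inv-r  : ∀ x → fun (inv x) ≡ x
open Perm public

InB : ∀ {n} → Perm (SignedSet n) → Set
InB τ = ∀ x → fun τ (neg x) ≡ neg (fun τ x)

iter : {A : Set} → (A → A) → ℕ → A → A
iter f zero    x = x
iter f (suc k) x = f (iter f k x)

SameOrbit : {A : Set} → (A → A) → A → A → Set
SameOrbit f x y = ∃ λ k → iter f k x ≡ y

-- x and y lie in the same orbit of the group generated by f and g
-- (on a finite set, forward words in f and g suffice).
data Reach₂ {A : Set} (f g : A → A) : A → A → Set where
  here  : ∀ {x} → Reach₂ f g x x
  stepf : ∀ {x y} → Reach₂ f g x y → Reach₂ f g x (f y)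
  stepg : ∀ {x y} → Reach₂ f g x y → Reach₂ f g x (g y)

-- "The equivalence relation R has exactly k classes": there is a
-- surjective labelling of A by Fin k whose fibres are exactly the classes.
NumClasses : {A : Set} → (A → A → Set) → ℕ → Set
NumClasses {A} R k =
  Σ (A → Fin k) λ c →
    (∀ j → ∃ λ x → c x ≡ j) × (∀ x y → (c x ≡ c y) ⇔ R x y)

NumOrbits : {A : Set} → (A → A) → ℕ → Set
NumOrbits f k = NumClasses (SameOrbit f) k

NumOrbits₂ : {A : Set} → (A → A) → (A → A) → ℕ → Set
NumOrbits₂ f g k = NumClasses (Reach₂ f g) k

-- successor on the cycle (0,+) → (1,+) → … → (m-1,+) → (0,-) → … → (m-1,-) → (0,+)
cyc : ∀ m → SignedSet m → SignedSet m
cyc (suc m) (i , s) with m ≟ toℕ i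
... | yes _  = zero , not s
... | no m≢i = suc (lower₁ i m≢i) , s

-- γ = (1,…,p,-1,…,-p)(p+1,…,n,-(p+1),…,-n) on X with n = p + q.
gamma : ∀ p q → SignedSet (p + q) → SignedSet (p + q)
gamma p q (i , s) with splitAt p i
... | inj₁ j with cyc p (j , s)
...   | (j' , s') = (j' ↑ˡ q) , s'
gamma p q (i , s) | inj₂ j with cyc q (j , s)
...   | (j' , s') = (p ↑ʳ j') , s'

InY : ∀ p q → SignedSet (p + q) → Set
InY p q (i , _) = ∃ λ j → splitAt p i ≡ inj₁ j

InZ : ∀ p q → SignedSet (p + q) → Set
InZ p q (i , _) = ∃ λ j → splitAt p i ≡ inj₂ j

-- S_nc(X, γ): #(τ) + #(τ⁻¹γ) + #(γ) = |X| + 2 #(τ, γ), with |X| = 2n.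
NonCrossing : ∀ p q → Perm (SignedSet (p + q)) → Set
NonCrossing p q τ =
  ∃ λ a → ∃ λ b → ∃ λ c → ∃ λ d →
    NumOrbits (fun τ) a × NumOrbits (λ x → inv τ (gamma p q x)) b ×
    NumOrbits (gamma p q) c × NumOrbits₂ (fun τ) (gamma p q) d ×
    (a + b + c ≡ 2 * (p + q) + 2 * d)

InSBnc : ∀ p q → Perm (SignedSet (p + q)) → Set
InSBnc p q τ = NonCrossing p q τ × InB τ

GammaConnected : ∀ p q → Perm (SignedSet (p + q)) → Set
GammaConnected p q τ =
  ∃ λ x → ∃ λ y → InY p q x × InZ p q y × SameOrbit (fun τ) x y

InversionInvariantOrbitOf : ∀ {n} → Perm (SignedSet n) → SignedSet n → Set
InversionInvariantOrbitOf τ x =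
  ∀ y → SameOrbit (fun τ) x y ⇔ SameOrbit (fun τ) x (neg y)

module Submission where

-- Suppose the τ-orbit of u contains -u, and let w = τ u.  Then
--   σ = τ ∘ (u -u)  cuts that orbit into two:            #σ = #τ + 1,
--   γ̂ = (w -w) ∘ γ  cuts the γ-cycle through w and -w:   #γ̂ = #γ + 1,
--   σ⁻¹γ̂ = τ⁻¹γ, because τ commutes with x ↦ -x, and
--   #⟨σ, γ̂⟩ ≤ #⟨τ, γ⟩, because γ-connectedness forces u and -u into one
--   ⟨σ, γ̂⟩-orbit.
-- The genus inequality  #f + #(f⁻¹g) + #g ≤ |X| + 2 #⟨f, g⟩  for (σ, γ̂) then
-- exceeds by 2 the equality that defines τ ∈ S_nc(X, γ), a contradiction.

open import Defs
open import Data.Nat using (ℕ; zero; suc; _+_; _*_; _∸_; _≤_; _<_; z≤n; s≤s)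
import Data.Nat.Properties as ℕₚ
open import Data.Nat.Tactic.RingSolver using (solve-∀)
open import Data.Fin as Fin using (Fin; toℕ; _↑ˡ_; _↑ʳ_)
import Data.Fin.Properties as Finₚ
open import Data.Bool using (true; false; not)
import Data.Bool.Properties as Boolₚ
open import Data.Product using (∃; _×_; _,_; proj₁; proj₂)
open import Data.Product.Function.NonDependent.Propositional using (_×-↔_)
open import Data.Sum using (_⊎_; inj₁; inj₂)
open import Data.Empty using (⊥; ⊥-elim)
open import Relation.Nullary using (¬_; Dec; yes; no; ¬?)
open import Relation.Nullary.Decidable using (map′)
open import Relation.Binary.Definitions using (DecidableEquality)
open import Relation.Binary.Structures using (IsEquivalence)
import Relation.Binary.Construct.On as On
open import Relation.Binary.PropositionalEquality
open import Function using (_∘_; _on_)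
open import Function.Bundles using (_⇔_; mk⇔; _↔_; Inverse; Equivalence)
open import Function.Definitions using (Injective)
open import Function.Construct.Identity using (↔-id)
open import Function.Construct.Composition using (_↔-∘_)
open import Function.Construct.Symmetry using (↔-sym)

Inj : {A : Set} → (A → A) → Set
Inj f = Injective _≡_ _≡_ f

perm-injective : {A : Set} (π : Perm A) → Inj (fun π)
perm-injective π {x} {y} e = trans (sym (inv-l π x)) (trans (cong (inv π) e) (inv-l π y))

iter-suc : {A : Set} (f : A → A) (k : ℕ) (x : A) → iter f (suc k) x ≡ iter f k (f x)
iter-suc f zero    x = refl
iter-suc f (suc k) x = cong f (iter-suc f k x)

iter-+ : {A : Set} (f : A → A) (i j : ℕ) (x : A) → iter f (i + j) x ≡ iter f i (iter f j x)
iter-+ f zero    j x = refl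
iter-+ f (suc i) j x = cong f (iter-+ f i j x)

iter-periodic : {A : Set} (f : A → A) (j : ℕ) (x : A) → iter f j x ≡ x → ∀ k → iter f (k * j) x ≡ x
iter-periodic f j x e zero    = refl
iter-periodic f j x e (suc k) =
  trans (iter-+ f j (k * j) x) (trans (cong (iter f j) (iter-periodic f j x e k)) e)

iter-injective : {A : Set} (f : A → A) → Inj f → ∀ k {x y} → iter f k x ≡ iter f k y → x ≡ y
iter-injective f f-inj zero    e = e
iter-injective f f-inj (suc k) e = iter-injective f f-inj k (f-inj e)

iter-cong : {A : Set} {f g : A → A} → (∀ x → f x ≡ g x) → ∀ k x → iter f k x ≡ iter g k x
iter-cong f≗g zero    x = refl
iter-cong {f = f} f≗g (suc k) x = trans (cong f (iter-cong f≗g k x)) (f≗g _)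

-- The orbit relation is reflexive and transitive for every map; symmetry
-- needs finiteness and injectivity (see 'Finite.orbit-sym').
orbit-refl : {A : Set} (f : A → A) (x : A) → SameOrbit f x x
orbit-refl f x = 0 , refl

orbit-step : {A : Set} (f : A → A) (x : A) → SameOrbit f x (f x)
orbit-step f x = 1 , refl

orbit-trans : {A : Set} (f : A → A) {x y z : A} → SameOrbit f x y → SameOrbit f y z → SameOrbit f x z
orbit-trans f {x} (k₁ , refl) (k₂ , refl) = k₂ + k₁ , iter-+ f k₂ k₁ x

orbit-cong : {A : Set} {f g : A → A} → (∀ x → f x ≡ g x) → ∀ {x y} → SameOrbit f x y → SameOrbit g x y
orbit-cong f≗g {x} (k , e) = k , trans (sym (iter-cong f≗g k x)) e

reach-trans : {A : Set} {f g : A → A} {x y z : A} → Reach₂ f g x y → Reach₂ f g y z → Reach₂ f g x z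
reach-trans r here      = r
reach-trans r (stepf s) = stepf (reach-trans r s)
reach-trans r (stepg s) = stepg (reach-trans r s)

reach-iterf : {A : Set} {f g : A → A} (k : ℕ) (x : A) → Reach₂ f g x (iter f k x)
reach-iterf zero    x = here
reach-iterf (suc k) x = stepf (reach-iterf k x)

reach-iterg : {A : Set} {f g : A → A} (k : ℕ) (x : A) → Reach₂ f g x (iter g k x)
reach-iterg zero    x = here
reach-iterg (suc k) x = stepg (reach-iterg k x)

module _ {A : Set} {R : A → A → Set} (isEq : IsEquivalence R) where
  private module E = IsEquivalence isEq

  orbit-least : (f : A → A) → (∀ z → R z (f z)) → ∀ {x y} → SameOrbit f x y → R x y
  orbit-least f step (zero  , refl) = E.refl
  orbit-least f step (suc k , refl) = E.trans (orbit-least f step (k , refl)) (step _)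

  reach-least : (f g : A → A) → (∀ z → R z (f z)) → (∀ z → R z (g z)) →
                ∀ {x y} → Reach₂ f g x y → R x y
  reach-least f g stepf' stepg' here      = E.refl
  reach-least f g stepf' stepg' (stepf r) = E.trans (reach-least f g stepf' stepg' r) (stepf' _)
  reach-least f g stepf' stepg' (stepg r) = E.trans (reach-least f g stepf' stepg' r) (stepg' _)

-- 'Linked R a b' is the equivalence relation generated by R and one more
-- pair a ~ b: it is how orbits change when a transposition merges two cycles.
Linked : {A : Set} → (A → A → Set) → A → A → A → A → Set
Linked R a b u v = R u v ⊎ (R u a × R b v) ⊎ (R u b × R a v)

linked-least : {A : Set} {R S : A → A → Set} {a b : A} → IsEquivalence S → (∀ {u v} → R u v → S u v) → S a b →
               ∀ {u v} → Linked R a b u v → S u v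
linked-least isEqS R⊆S Sab (inj₁ r)                = R⊆S r
linked-least isEqS R⊆S Sab (inj₂ (inj₁ (r₁ , r₂))) = S.trans (R⊆S r₁) (S.trans Sab (R⊆S r₂))
  where module S = IsEquivalence isEqS
linked-least isEqS R⊆S Sab (inj₂ (inj₂ (r₁ , r₂))) = S.trans (R⊆S r₁) (S.trans (S.sym Sab) (R⊆S r₂))
  where module S = IsEquivalence isEqS

module _ {A : Set} {R : A → A → Set} (isEq : IsEquivalence R) {a b : A} where
  private module E = IsEquivalence isEq

  linked-isEquivalence : IsEquivalence (Linked R a b)
  linked-isEquivalence = record { refl = inj₁ E.refl ; sym = symm ; trans = tran }
    where
    symm : ∀ {x y} → Linked R a b x y → Linked R a b y x
    symm (inj₁ r)                = inj₁ (E.sym r)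
    symm (inj₂ (inj₁ (r₁ , r₂))) = inj₂ (inj₂ (E.sym r₂ , E.sym r₁))
    symm (inj₂ (inj₂ (r₁ , r₂))) = inj₂ (inj₁ (E.sym r₂ , E.sym r₁))
    tran : ∀ {x y z} → Linked R a b x y → Linked R a b y z → Linked R a b x z
    tran (inj₁ r)                (inj₁ s)                = inj₁ (E.trans r s)
    tran (inj₁ r)                (inj₂ (inj₁ (s₁ , s₂))) = inj₂ (inj₁ (E.trans r s₁ , s₂))
    tran (inj₁ r)                (inj₂ (inj₂ (s₁ , s₂))) = inj₂ (inj₂ (E.trans r s₁ , s₂))
    tran (inj₂ (inj₁ (r₁ , r₂))) (inj₁ s)                = inj₂ (inj₁ (r₁ , E.trans r₂ s))
    tran (inj₂ (inj₁ (r₁ , r₂))) (inj₂ (inj₁ (s₁ , s₂))) = inj₂ (inj₁ (r₁ , s₂))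
    tran (inj₂ (inj₁ (r₁ , r₂))) (inj₂ (inj₂ (s₁ , s₂))) = inj₁ (E.trans r₁ s₂)
    tran (inj₂ (inj₂ (r₁ , r₂))) (inj₁ s)                = inj₂ (inj₂ (r₁ , E.trans r₂ s))
    tran (inj₂ (inj₂ (r₁ , r₂))) (inj₂ (inj₁ (s₁ , s₂))) = inj₁ (E.trans r₁ s₂)
    tran (inj₂ (inj₂ (r₁ , r₂))) (inj₂ (inj₂ (s₁ , s₂))) = inj₂ (inj₂ (r₁ , s₂))

  linked-link : Linked R a b a b
  linked-link = inj₂ (inj₁ (E.refl , E.refl))

  linked-collapse : R a b → ∀ {u v} → Linked R a b u v → R u v
  linked-collapse = linked-least isEq (λ r → r)

least-or-none : (P : ℕ → Set) → (∀ n → Dec (P n)) → ∀ bound →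
                (∃ λ m → P m × (∀ i → i < m → ¬ P i)) ⊎ (∀ i → i < bound → ¬ P i)
least-or-none P P? zero = inj₂ (λ i ())
least-or-none P P? (suc bound) with least-or-none P P? bound
... | inj₁ found = inj₁ found
... | inj₂ none with P? bound
...   | yes pb = inj₁ (bound , pb , none)
...   | no ¬pb = inj₂ below
  where
  below : ∀ i → i < suc bound → ¬ P i
  below i i<1+b with ℕₚ.m<1+n⇒m<n∨m≡n i<1+b
  ... | inj₁ i<b  = none i i<b
  ... | inj₂ refl = ¬pb

least-witness : (P : ℕ → Set) → (∀ n → Dec (P n)) → ∃ P →
                ∃ λ m → P m × (∀ i → i < m → ¬ P i)
least-witness P P? (k , pk) with least-or-none P P? (suc k)
... | inj₁ found = found
... | inj₂ none  = ⊥-elim (none k (ℕₚ.n<1+n k) pk)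

module Finite {C : Set} {N : ℕ} (enum : C ↔ Fin N) where
  open Inverse enum using (to; from; strictlyInverseˡ; strictlyInverseʳ)
  open Equivalence using () renaming (to to ⇒; from to ⇐)

  to-injective : ∀ {x y} → to x ≡ to y → x ≡ y
  to-injective {x} {y} e = trans (sym (strictlyInverseʳ x)) (trans (cong from e) (strictlyInverseʳ y))

  _≟_ : DecidableEquality C
  x ≟ y = map′ to-injective (cong to) (to x Fin.≟ to y)

  -- Pigeonhole: every point is periodic under an injective map of C.
  period : (f : C → C) → Inj f → ∀ x → ∃ λ j → iter f (suc j) x ≡ x
  period f f-inj x with Finₚ.pigeonhole (ℕₚ.n<1+n N) (λ i → to (iter f (toℕ i) x))
  ... | i , j , i<j , e = d , iter-injective f f-inj (toℕ i) (begin
      iter f (toℕ i) (iter f (suc d) x) ≡⟨ iter-+ f (toℕ i) (suc d) x ⟨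
      iter f (toℕ i + suc d) x          ≡⟨ cong (λ t → iter f t x) i+1+d≡j ⟩
      iter f (toℕ j) x                  ≡⟨ to-injective e ⟨
      iter f (toℕ i) x                  ∎)
    where
    open ≡-Reasoning
    d : ℕ
    d = toℕ j ∸ suc (toℕ i)
    i+1+d≡j : toℕ i + suc d ≡ toℕ j
    i+1+d≡j = trans (ℕₚ.+-suc (toℕ i) d) (ℕₚ.m+[n∸m]≡n i<j)

  orbit-sym : (f : C → C) → Inj f → ∀ {x y} → SameOrbit f x y → SameOrbit f y x
  orbit-sym f f-inj {x} (k , refl) with period f f-inj x
  ... | j , e = j * k , (begin
      iter f (j * k) (iter f k x) ≡⟨ iter-+ f (j * k) k x ⟨
      iter f (j * k + k) x        ≡⟨ cong (λ t → iter f t x) (ℕₚ.+-comm (j * k) k) ⟩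
      iter f (suc j * k) x        ≡⟨ cong (λ t → iter f t x) (ℕₚ.*-comm (suc j) k) ⟩
      iter f (k * suc j) x        ≡⟨ iter-periodic f (suc j) x e k ⟩
      x                           ∎)
    where open ≡-Reasoning

  orbit-isEquivalence : (f : C → C) → Inj f → IsEquivalence (SameOrbit f)
  orbit-isEquivalence f f-inj = record
    { refl = orbit-refl f _ ; sym = orbit-sym f f-inj ; trans = orbit-trans f }

  preimage : (f : C → C) → Inj f → ∀ y → ∃ λ z → f z ≡ y
  preimage f f-inj y with period f f-inj y
  ... | j , e = iter f j y , e

  reach-sym : (f g : C → C) → Inj f → Inj g → ∀ {x y} → Reach₂ f g x y → Reach₂ f g y x
  reach-sym f g f-inj g-inj = sym′
    where
    -- a step along an injective map is undone by going once around its cycle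
    undo : (h : C → C) → Inj h → (∀ k x → Reach₂ f g x (iter h k x)) → ∀ y → Reach₂ f g (h y) y
    undo h h-inj forward y with period h h-inj y
    ... | j , e = subst (Reach₂ f g (h y)) (trans (sym (iter-suc h j y)) e) (forward j (h y))
    sym′ : ∀ {x y} → Reach₂ f g x y → Reach₂ f g y x
    sym′ here      = here
    sym′ (stepf r) = reach-trans (undo f f-inj reach-iterf _) (sym′ r)
    sym′ (stepg r) = reach-trans (undo g g-inj reach-iterg _) (sym′ r)

  reach-isEquivalence : (f g : C → C) → Inj f → Inj g → IsEquivalence (Reach₂ f g)
  reach-isEquivalence f g f-inj g-inj = record
    { refl = here ; sym = reach-sym f g f-inj g-inj ; trans = reach-trans }

  -- Comparing class counts.  Each lemma builds an injection between finite
  -- sets of labels and applies 'Finₚ.injective⇒≤'.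

  classes≤size : ∀ {R : C → C → Set} {k} → NumClasses R k → k ≤ N
  classes≤size {k = k} (c , onto , _) = Finₚ.injective⇒≤ label-inj
    where
    label-inj : ∀ {i j} → to (proj₁ (onto i)) ≡ to (proj₁ (onto j)) → i ≡ j
    label-inj {i} {j} e = trans (sym (proj₂ (onto i))) (trans (cong c (to-injective e)) (proj₂ (onto j)))

  classes-antitone : ∀ {R S : C → C → Set} {k k'} → (∀ {x y} → R x y → S x y) →
                     NumClasses R k → NumClasses S k' → k' ≤ k
  classes-antitone R⊆S (c , _ , c≡⇔R) (c' , onto' , c'≡⇔S) = Finₚ.injective⇒≤ label-inj
    where
    label-inj : ∀ {i j} → c (proj₁ (onto' i)) ≡ c (proj₁ (onto' j)) → i ≡ j
    label-inj {i} {j} e =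
      trans (sym (proj₂ (onto' i))) (trans (⇐ (c'≡⇔S _ _) (R⊆S (⇒ (c≡⇔R _ _) e))) (proj₂ (onto' j)))

  classes-unique : ∀ {R S : C → C → Set} {k k'} → (∀ {x y} → R x y → S x y) → (∀ {x y} → S x y → R x y) →
                   NumClasses R k → NumClasses S k' → k ≡ k'
  classes-unique R⊆S S⊆R cR cS = ℕₚ.≤-antisym (classes-antitone S⊆R cS cR) (classes-antitone R⊆S cR cS)

  classes-resp : ∀ {R S : C → C → Set} {k} → (∀ {x y} → R x y → S x y) → (∀ {x y} → S x y → R x y) →
                 NumClasses R k → NumClasses S k
  classes-resp R⊆S S⊆R (c , onto , c≡⇔R) =
    c , onto , λ x y → mk⇔ (R⊆S ∘ ⇒ (c≡⇔R x y)) (⇐ (c≡⇔R x y) ∘ S⊆R)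

  classes-linked-≤ : ∀ {R S : C → C → Set} {a b k k'} → (∀ {x y} → S x y → Linked R a b x y) →
                     NumClasses R k → NumClasses S k' → k ≤ suc k'
  classes-linked-≤ {R} {S} {a} {b} {k} {k'} S⊆L (c , onto , c≡⇔R) (c' , _ , c'≡⇔S) =
    Finₚ.injective⇒≤ {f = label} label-inj
    where
    -- the class of b gets the fresh label zero, the others their S-class
    label′ : (i : Fin k) → Dec (i ≡ c b) → Fin (suc k')
    label′ i (yes _) = Fin.zero
    label′ i (no _)  = Fin.suc (c' (proj₁ (onto i)))
    label : Fin k → Fin (suc k')
    label i = label′ i (i Fin.≟ c b)
    inj′ : ∀ i j (di : Dec (i ≡ c b)) (dj : Dec (j ≡ c b)) → label′ i di ≡ label′ j dj → i ≡ j
    inj′ i j (yes i≡) (yes j≡) e = trans i≡ (sym j≡)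
    inj′ i j (no i≢)  (no j≢)  e with S⊆L (⇒ (c'≡⇔S _ _) (Finₚ.suc-injective e))
    ... | inj₁ r = trans (sym (proj₂ (onto i))) (trans (⇐ (c≡⇔R _ _) r) (proj₂ (onto j)))
    ... | inj₂ (inj₁ (_ , r)) = ⊥-elim (j≢ (trans (sym (proj₂ (onto j))) (sym (⇐ (c≡⇔R _ _) r))))
    ... | inj₂ (inj₂ (r , _)) = ⊥-elim (i≢ (trans (sym (proj₂ (onto i))) (⇐ (c≡⇔R _ _) r)))
    label-inj : ∀ {i j} → label i ≡ label j → i ≡ j
    label-inj {i} {j} = inj′ i j (i Fin.≟ c b) (j Fin.≟ c b)

  classes-separated : ∀ {R S : C → C → Set} {a b k k'} → (∀ {x y} → R x y → S x y) → S a b → ¬ R a b →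
                      NumClasses R k → NumClasses S k' → suc k' ≤ k
  classes-separated {R} {S} {a} {b} {k} {k'} R⊆S Sab ¬Rab (c , _ , c≡⇔R) (c' , onto' , c'≡⇔S) =
    Finₚ.injective⇒≤ {f = label} label-inj
    where
    -- pick a representative of each S-class, choosing a for the class of a
    rep′ : (j : Fin k') → Dec (j ≡ c' a) → C
    rep′ j (yes _) = a
    rep′ j (no _)  = proj₁ (onto' j)
    rep′-class : ∀ j d → c' (rep′ j d) ≡ j
    rep′-class j (yes j≡) = sym j≡
    rep′-class j (no _)   = proj₂ (onto' j)
    rep : Fin k' → C
    rep j = rep′ j (j Fin.≟ c' a)
    -- b is mapped apart from all representatives
    label : Fin (suc k') → Fin k
    label Fin.zero    = c b
    label (Fin.suc j) = c (rep j)
    S-of : ∀ {x y} → c x ≡ c y → c' x ≡ c' y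
    S-of e = ⇐ (c'≡⇔S _ _) (R⊆S (⇒ (c≡⇔R _ _) e))
    b-apart : ∀ j d → c (rep′ j d) ≢ c b
    b-apart j (yes _)  e = ¬Rab (⇒ (c≡⇔R _ _) e)
    b-apart j (no j≢) e =
      j≢ (trans (sym (proj₂ (onto' j))) (trans (S-of e) (sym (⇐ (c'≡⇔S _ _) Sab))))
    label-inj : ∀ {i j} → label i ≡ label j → i ≡ j
    label-inj {Fin.zero}  {Fin.zero}  e = refl
    label-inj {Fin.suc i} {Fin.suc j} e = cong Fin.suc
      (trans (sym (rep′-class i (i Fin.≟ c' a))) (trans (S-of e) (rep′-class j (j Fin.≟ c' a))))
    label-inj {Fin.zero}  {Fin.suc j} e = ⊥-elim (b-apart j (j Fin.≟ c' a) (sym e))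
    label-inj {Fin.suc i} {Fin.zero}  e = ⊥-elim (b-apart i (i Fin.≟ c' a) e)

  classes-one-link : ∀ {R S : C → C → Set} {a b k k'} → (∀ {x y} → R x y → S x y) →
                     (∀ {x y} → S x y → Linked R a b x y) → S a b → ¬ R a b →
                     NumClasses R k → NumClasses S k' → k ≡ suc k'
  classes-one-link R⊆S S⊆L Sab ¬Rab cR cS =
    ℕₚ.≤-antisym (classes-linked-≤ S⊆L cR cS) (classes-separated R⊆S Sab ¬Rab cR cS)

  classes-decidable : ∀ {R : C → C → Set} {k} → NumClasses R k → ∀ x y → Dec (R x y)
  classes-decidable (c , _ , c≡⇔R) x y = map′ (⇒ (c≡⇔R x y)) (⇐ (c≡⇔R x y)) (c x Fin.≟ c y)

  drop-unused-label : ∀ {R : C → C → Set} {k} (c : C → Fin (suc k)) (i : Fin (suc k)) →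
                      (∀ z → i ≢ c z) → (∀ j → j ≢ i → ∃ λ z → c z ≡ j) →
                      (∀ x y → (c x ≡ c y) ⇔ R x y) → NumClasses R k
  drop-unused-label {R} {k} c i unused onto c≡⇔R = label , label-onto , label≡⇔R
    where
    label : C → Fin k
    label z = Fin.punchOut (unused z)
    label-onto : ∀ j → ∃ λ z → label z ≡ j
    label-onto j with onto (Fin.punchIn i j) (Finₚ.punchInᵢ≢i i j)
    ... | z , cz≡ = z , trans (Finₚ.punchOut-cong i cz≡) (Finₚ.punchOut-punchIn i)
    label≡⇔R : ∀ x y → (label x ≡ label y) ⇔ R x y
    label≡⇔R x y = mk⇔ (⇒ (c≡⇔R x y) ∘ Finₚ.punchOut-injective (unused x) (unused y))
                       (Finₚ.punchOut-cong i ∘ ⇐ (c≡⇔R x y))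

  merged : ∀ {k} → (C → Fin k) → C → C → C → Fin k
  merged c a b z with c z Fin.≟ c b
  ... | yes _ = c a
  ... | no _  = c z

  merged-fibres : ∀ {R : C → C → Set} {k} (c : C → Fin k) → (∀ x y → (c x ≡ c y) ⇔ R x y) →
                  ∀ a b x y → (merged c a b x ≡ merged c a b y) ⇔ Linked R a b x y
  merged-fibres {R} c c≡⇔R a b x y = mk⇔ (fibre⇒linked x y)
    (linked-least {S = _≡_ on merged c a b} (On.isEquivalence (merged c a b) isEquivalence) fibre-R fibre-ab)
    where
    R-of : ∀ {x y} → c x ≡ c y → R x y
    R-of = ⇒ (c≡⇔R _ _)
    fibre⇒linked : ∀ x y → merged c a b x ≡ merged c a b y → Linked R a b x y
    fibre⇒linked x y e with c x Fin.≟ c b | c y Fin.≟ c b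
    ... | yes xb | yes yb = inj₁ (R-of (trans xb (sym yb)))
    ... | yes xb | no _   = inj₂ (inj₂ (R-of xb , R-of e))
    ... | no _   | yes yb = inj₂ (inj₁ (R-of e , R-of (sym yb)))
    ... | no _   | no _   = inj₁ (R-of e)
    fibre-R : ∀ {x y} → R x y → merged c a b x ≡ merged c a b y
    fibre-R {x} {y} r with ⇐ (c≡⇔R x y) r | c x Fin.≟ c b | c y Fin.≟ c b
    ... | _  | yes _  | yes _  = refl
    ... | e  | yes xb | no ¬yb = ⊥-elim (¬yb (trans (sym e) xb))
    ... | e  | no ¬xb | yes yb = ⊥-elim (¬xb (trans e yb))
    ... | e  | no _   | no _   = e
    fibre-ab : merged c a b a ≡ merged c a b b
    fibre-ab with c a Fin.≟ c b | c b Fin.≟ c b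
    ... | _     | no ¬bb = ⊥-elim (¬bb refl)
    ... | yes _ | yes _  = refl
    ... | no _  | yes _  = refl

  classes-merge : ∀ {R : C → C → Set} {k a b} → NumClasses R k → ¬ R a b →
                  ∃ λ k' → NumClasses (Linked R a b) k'
  classes-merge {R} {zero}   {a} {b} (c , _ , _) ¬Rab with c b
  ... | ()
  classes-merge {R} {suc k'} {a} {b} (c , onto , c≡⇔R) ¬Rab =
    k' , drop-unused-label (merged c a b) (c b) unused onto′ (merged-fibres c c≡⇔R a b)
    where
    unused : ∀ z → c b ≢ merged c a b z
    unused z with c z Fin.≟ c b
    ... | yes _  = λ cb≡ca → ¬Rab (⇒ (c≡⇔R a b) (sym cb≡ca))
    ... | no ¬zb = ¬zb ∘ sym
    keeps : ∀ z → c z ≢ c b → merged c a b z ≡ c z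
    keeps z ¬zb with c z Fin.≟ c b
    ... | yes zb = ⊥-elim (¬zb zb)
    ... | no _   = refl
    onto′ : ∀ j → j ≢ c b → ∃ λ z → merged c a b z ≡ j
    onto′ j j≢cb with onto j
    ... | z , refl = z , keeps z j≢cb

  -- The equivalence relation generated by finitely many links; it always
  -- has a class count, which gives class counts for orbits.
  Generated : ∀ {M} → (Fin M → C × C) → C → C → Set
  Generated {zero}  links = _≡_
  Generated {suc M} links = Linked (Generated (links ∘ Fin.suc)) (proj₁ (links Fin.zero)) (proj₂ (links Fin.zero))

  generated-isEquivalence : ∀ {M} (links : Fin M → C × C) → IsEquivalence (Generated links)
  generated-isEquivalence {zero}  links = isEquivalence
  generated-isEquivalence {suc M} links = linked-isEquivalence (generated-isEquivalence (links ∘ Fin.suc))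

  generated-link : ∀ {M} (links : Fin M → C × C) i → Generated links (proj₁ (links i)) (proj₂ (links i))
  generated-link {suc M} links Fin.zero    = linked-link (generated-isEquivalence (links ∘ Fin.suc))
  generated-link {suc M} links (Fin.suc i) = inj₁ (generated-link (links ∘ Fin.suc) i)

  generated-least : ∀ {M} (links : Fin M → C × C) {R : C → C → Set} → IsEquivalence R →
                    (∀ i → R (proj₁ (links i)) (proj₂ (links i))) → ∀ {x y} → Generated links x y → R x y
  generated-least {zero}  links isEq linked refl = IsEquivalence.refl isEq
  generated-least {suc M} links isEq linked =
    linked-least isEq (generated-least (links ∘ Fin.suc) isEq (linked ∘ Fin.suc)) (linked Fin.zero)

  generated-classes : ∀ {M} (links : Fin M → C × C) → ∃ λ k → NumClasses (Generated links) k
  generated-classes {zero}  links = N , to , (λ j → from j , strictlyInverseˡ j) , λ x y → mk⇔ to-injective (cong to)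
  generated-classes {suc M} links with generated-classes (links ∘ Fin.suc)
  ... | k , cnt@(c , _ , c≡⇔R) with c (proj₁ (links Fin.zero)) Fin.≟ c (proj₂ (links Fin.zero))
  ...   | yes e = k , classes-resp inj₁ (linked-collapse (generated-isEquivalence (links ∘ Fin.suc)) (⇒ (c≡⇔R _ _) e)) cnt
  ...   | no ne = classes-merge cnt (ne ∘ ⇐ (c≡⇔R _ _))

  orbits-exist : (f : C → C) → Inj f → ∃ λ k → NumOrbits f k
  orbits-exist f f-inj = k , classes-resp (generated-least links (orbit-isEquivalence f f-inj) (λ _ → orbit-step f _))
                                          (orbit-least (generated-isEquivalence links) f step) cnt
    where
    links : Fin N → C × C
    links j = from j , f (from j)
    k : ℕ
    k = proj₁ (generated-classes links)
    cnt : NumClasses (Generated links) k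
    cnt = proj₂ (generated-classes links)
    step : ∀ z → Generated links z (f z)
    step z = subst (λ v → Generated links v (f v)) (strictlyInverseʳ z) (generated-link links (to z))

  orbits₂-exist : (f g : C → C) → Inj f → Inj g → ∃ λ k → NumOrbits₂ f g k
  orbits₂-exist f g f-inj g-inj =
    k , classes-resp (generated-least links (reach-isEquivalence f g f-inj g-inj) link-reach)
                     (reach-least (generated-isEquivalence links) f g step-f step-g) cnt
    where
    -- links z ~ f z for the first N indices and z ~ g z for the last N
    link′ : Fin N ⊎ Fin N → C × C
    link′ (inj₁ j) = from j , f (from j)
    link′ (inj₂ j) = from j , g (from j)
    links : Fin (N + N) → C × C
    links = link′ ∘ Fin.splitAt N
    k : ℕ
    k = proj₁ (generated-classes links)
    cnt : NumClasses (Generated links) k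
    cnt = proj₂ (generated-classes links)
    link-reach′ : ∀ s → Reach₂ f g (proj₁ (link′ s)) (proj₂ (link′ s))
    link-reach′ (inj₁ j) = stepf here
    link-reach′ (inj₂ j) = stepg here
    link-reach : ∀ i → Reach₂ f g (proj₁ (links i)) (proj₂ (links i))
    link-reach i = link-reach′ (Fin.splitAt N i)
    linked′ : ∀ s → Generated links (proj₁ (link′ s)) (proj₂ (link′ s))
    linked′ s = subst (λ s′ → Generated links (proj₁ (link′ s′)) (proj₂ (link′ s′)))
                      (Finₚ.splitAt-join N N s) (generated-link links (Fin.join N N s))
    step-f : ∀ z → Generated links z (f z)
    step-f z = subst (λ v → Generated links v (f v)) (strictlyInverseʳ z) (linked′ (inj₁ (to z)))
    step-g : ∀ z → Generated links z (g z)
    step-g z = subst (λ v → Generated links v (g v)) (strictlyInverseʳ z) (linked′ (inj₂ (to z)))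

  swap : C → C → C → C
  swap x y z with z ≟ x
  ... | yes _ = y
  ... | no _ with z ≟ y
  ...   | yes _ = x
  ...   | no _  = z

  swap-x : ∀ x y → swap x y x ≡ y
  swap-x x y with x ≟ x
  ... | yes _  = refl
  ... | no x≢x = ⊥-elim (x≢x refl)

  swap-y : ∀ x y → swap x y y ≡ x
  swap-y x y with y ≟ x
  ... | yes y≡x = y≡x
  ... | no _ with y ≟ y
  ...   | yes _  = refl
  ...   | no y≢y = ⊥-elim (y≢y refl)

  swap-other : ∀ x y z → z ≢ x → z ≢ y → swap x y z ≡ z
  swap-other x y z z≢x z≢y with z ≟ x
  ... | yes z≡x = ⊥-elim (z≢x z≡x)
  ... | no _ with z ≟ y
  ...   | yes z≡y = ⊥-elim (z≢y z≡y)
  ...   | no _    = refl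

  swap-involutive : ∀ x y z → swap x y (swap x y z) ≡ z
  swap-involutive x y z with z ≟ x
  ... | yes refl = swap-y x y
  ... | no z≢x with z ≟ y
  ...   | yes refl = swap-x x y
  ...   | no z≢y   = swap-other x y z z≢x z≢y

  swap-injective : ∀ x y → Inj (swap x y)
  swap-injective x y {u} {v} e =
    trans (sym (swap-involutive x y u)) (trans (cong (swap x y) e) (swap-involutive x y v))

  swap-comm : ∀ a b z → swap a b z ≡ swap b a z
  swap-comm a b z = by-cases (z ≟ a) (z ≟ b)
    where
    by-cases : Dec (z ≡ a) → Dec (z ≡ b) → swap a b z ≡ swap b a z
    by-cases (yes z≡a) _ = begin
      swap a b z  ≡⟨ cong (swap a b) z≡a ⟩
      swap a b a  ≡⟨ swap-x a b ⟩
      b           ≡⟨ swap-y b a ⟨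
      swap b a a  ≡⟨ cong (swap b a) z≡a ⟨
      swap b a z  ∎
      where open ≡-Reasoning
    by-cases (no _) (yes z≡b) = begin
      swap a b z  ≡⟨ cong (swap a b) z≡b ⟩
      swap a b b  ≡⟨ swap-y a b ⟩
      a           ≡⟨ swap-x b a ⟨
      swap b a b  ≡⟨ cong (swap b a) z≡b ⟨
      swap b a z  ∎
      where open ≡-Reasoning
    by-cases (no z≢a) (no z≢b) = trans (swap-other a b z z≢a z≢b) (sym (swap-other b a z z≢b z≢a))

  swap-natural : (π : C → C) → Inj π → ∀ a b z → swap (π a) (π b) (π z) ≡ π (swap a b z)
  swap-natural π π-inj a b z with z ≟ a
  ... | yes refl = swap-x _ _
  ... | no z≢a with z ≟ b
  ...   | yes refl = swap-y _ _
  ...   | no z≢b   = swap-other (π a) (π b) (π z) (z≢a ∘ π-inj) (z≢b ∘ π-inj)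

  swap-conjugate : (π : Perm C) → ∀ a b v → inv π (swap (fun π a) (fun π b) v) ≡ swap a b (inv π v)
  swap-conjugate π a b v = begin
    inv π (swap (fun π a) (fun π b) v)                    ≡⟨ cong (inv π ∘ swap (fun π a) (fun π b)) (inv-r π v) ⟨
    inv π (swap (fun π a) (fun π b) (fun π (inv π v)))    ≡⟨ cong (inv π) (swap-natural (fun π) (perm-injective π) a b (inv π v)) ⟩
    inv π (fun π (swap a b (inv π v)))                    ≡⟨ inv-l π _ ⟩
    swap a b (inv π v)                                    ∎
    where open ≡-Reasoning

  swapped : Perm C → C → C → Perm C
  swapped π x y = record
    { fun   = fun π ∘ swap x y
    ; inv   = swap x y ∘ inv π
    ; inv-l = λ z → trans (cong (swap x y) (inv-l π (swap x y z))) (swap-involutive x y z)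
    ; inv-r = λ z → trans (cong (fun π) (swap-involutive x y (inv π z))) (inv-r π z)
    }

  RightSwap : (C → C) → (C → C) → C → C → Set
  RightSwap f f' a b = ∀ z → f' z ≡ f (swap a b z)

  LeftSwap : (C → C) → (C → C) → C → C → Set
  LeftSwap f f' x y = ∀ z → f' z ≡ swap x y (f z)

  module _ {f f' : C → C} {a b : C} (e : RightSwap f f' a b) where
    right-at-a : f' a ≡ f b
    right-at-a = trans (e a) (cong f (swap-x a b))

    right-at-b : f' b ≡ f a
    right-at-b = trans (e b) (cong f (swap-y a b))

    right-elsewhere : ∀ z → z ≢ a → z ≢ b → f' z ≡ f z
    right-elsewhere z z≢a z≢b = trans (e z) (cong f (swap-other a b z z≢a z≢b))

    right-swap-sym : RightSwap f' f a b
    right-swap-sym z = sym (trans (e (swap a b z)) (cong f (swap-involutive a b z)))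

    orbit-right-swap : Inj f' → ∀ {x y} → SameOrbit f x y → Linked (SameOrbit f') a b x y
    orbit-right-swap f'-inj = orbit-least (linked-isEquivalence (orbit-isEquivalence f' f'-inj)) f step
      where
      step : ∀ z → Linked (SameOrbit f') a b z (f z)
      step z with z ≟ a
      ... | yes refl = inj₂ (inj₁ (orbit-refl f' a , 1 , right-at-b))
      ... | no z≢a with z ≟ b
      ...   | yes refl = inj₂ (inj₂ (orbit-refl f' b , 1 , right-at-a))
      ...   | no z≢b   = inj₁ (1 , right-elsewhere z z≢a z≢b)

    -- With f¹⁺ʲa = b (j least), the arc f¹a, …, f¹⁺ʲa = b
    -- is closed under f ∘ (a b), contains b and avoids a.
    split-orbit : Inj f' → SameOrbit f a b → a ≢ b → ¬ SameOrbit f' a b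
    split-orbit f'-inj (k , fᵏa≡b) a≢b a~b with orbit-sym f' f'-inj a~b
    ... | n , f'ⁿb≡a = a∉arc (subst Arc f'ⁿb≡a (arc-iter n b b∈arc))
      where
      Hits : ℕ → Set
      Hits i = iter f (suc i) a ≡ b
      some-hit : ∀ k → iter f k a ≡ b → ∃ Hits
      some-hit zero    e = ⊥-elim (a≢b e)
      some-hit (suc i) e = i , e
      least : ∃ λ j → Hits j × (∀ i → i < j → ¬ Hits i)
      least = least-witness Hits (λ i → iter f (suc i) a ≟ b) (some-hit k fᵏa≡b)
      j : ℕ
      j = proj₁ least
      f¹⁺ʲa≡b : iter f (suc j) a ≡ b
      f¹⁺ʲa≡b = proj₁ (proj₂ least)
      not-b : ∀ i → i < j → iter f (suc i) a ≢ b
      not-b = proj₂ (proj₂ least)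
      -- a return to a before reaching b would give an earlier hit of b
      not-a : ∀ i → i < j → iter f (suc i) a ≢ a
      not-a i i<j e = not-b (j ∸ suc i) (ℕₚ.∸-monoʳ-< (s≤s z≤n) i<j) (begin
        iter f (suc (j ∸ suc i)) a               ≡⟨ cong (iter f (suc (j ∸ suc i))) e ⟨
        iter f (suc (j ∸ suc i)) (iter f (suc i) a) ≡⟨ iter-+ f (suc (j ∸ suc i)) (suc i) a ⟨
        iter f (suc (j ∸ suc i) + suc i) a         ≡⟨ cong (λ t → iter f (suc t) a) (ℕₚ.m∸n+n≡m i<j) ⟩
        iter f (suc j) a                          ≡⟨ f¹⁺ʲa≡b ⟩
        b                                         ∎)
        where open ≡-Reasoning
      Arc : C → Set
      Arc z = ∃ λ i → (i ≤ j) × (iter f (suc i) a ≡ z)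
      arc-step : ∀ z → Arc z → Arc (f' z)
      arc-step z (i , i≤j , refl) with ℕₚ.m≤n⇒m<n∨m≡n i≤j
      ... | inj₁ i<j  = suc i , i<j , sym (right-elsewhere _ (not-a i i<j) (not-b i i<j))
      ... | inj₂ refl = 0 , z≤n , trans (sym right-at-b) (cong f' (sym f¹⁺ʲa≡b))
      arc-iter : ∀ n z → Arc z → Arc (iter f' n z)
      arc-iter zero    z z∈arc = z∈arc
      arc-iter (suc n) z z∈arc = arc-step _ (arc-iter n z z∈arc)
      b∈arc : Arc b
      b∈arc = j , ℕₚ.≤-refl , f¹⁺ʲa≡b
      a∉arc : ¬ Arc a
      a∉arc (i , i≤j , e) with ℕₚ.m≤n⇒m<n∨m≡n i≤j
      ... | inj₁ i<j  = not-a i i<j e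
      ... | inj₂ refl = a≢b (trans (sym e) f¹⁺ʲa≡b)

    -- Join: if a and b lie on different cycles of f, then f ∘ (a b) carries
    -- a along the whole cycle of b, of length 1 + j, back to b.
    join-orbits : Inj f → ¬ SameOrbit f a b → SameOrbit f' a b
    join-orbits f-inj a≁b = suc j , trans (along j ℕₚ.≤-refl) f¹⁺ʲb≡b
      where
      Returns : ℕ → Set
      Returns i = iter f (suc i) b ≡ b
      least : ∃ λ j → Returns j × (∀ i → i < j → ¬ Returns i)
      least = least-witness Returns (λ i → iter f (suc i) b ≟ b) (period f f-inj b)
      j : ℕ
      j = proj₁ least
      f¹⁺ʲb≡b : iter f (suc j) b ≡ b
      f¹⁺ʲb≡b = proj₁ (proj₂ least)
      along : ∀ i → i ≤ j → iter f' (suc i) a ≡ iter f (suc i) b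
      along zero    _   = right-at-a
      along (suc i) i<j = trans (cong f' (along i (ℕₚ.<⇒≤ i<j)))
        (right-elsewhere _ (λ e → a≁b (orbit-sym f f-inj (suc i , e))) (proj₂ (proj₂ least) i i<j))

  split-count : ∀ {f f' a b k k'} → Inj f → Inj f' → RightSwap f f' a b → SameOrbit f a b → a ≢ b →
                NumOrbits f k → NumOrbits f' k' → k' ≡ suc k
  split-count f-inj f'-inj e a~b a≢b cf cf' =
    classes-one-link (linked-collapse (orbit-isEquivalence _ f-inj) a~b ∘ orbit-right-swap (right-swap-sym e) f-inj)
                     (orbit-right-swap e f'-inj) a~b (split-orbit e f'-inj a~b a≢b) cf' cf

  join-count : ∀ {f f' a b k k'} → Inj f → Inj f' → RightSwap f f' a b → ¬ SameOrbit f a b →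
               NumOrbits f k → NumOrbits f' k' → k ≡ suc k'
  join-count f-inj f'-inj e a≁b cf cf' =
    classes-one-link (linked-collapse (orbit-isEquivalence _ f'-inj) (join-orbits e f-inj a≁b) ∘ orbit-right-swap e f'-inj)
                     (orbit-right-swap (right-swap-sym e) f-inj) (join-orbits e f-inj a≁b) a≁b cf cf'

  -- A left transposition (x y) ∘ f is the right transposition f ∘ (a b)
  -- at the preimages a, b of x, y.  (Matching on z ≟ a and z ≟ b also
  -- evaluates swap a b z in the goal.)
  left⇒right : ∀ {f f' x y a b} → Inj f → LeftSwap f f' x y → f a ≡ x → f b ≡ y → RightSwap f f' a b
  left⇒right {f} {f'} {x} {y} {a} {b} f-inj e fa≡x fb≡y z with z ≟ a
  ... | yes refl = begin
    f' a              ≡⟨ e a ⟩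
    swap x y (f a)    ≡⟨ cong (swap x y) fa≡x ⟩
    swap x y x        ≡⟨ swap-x x y ⟩
    y                 ≡⟨ fb≡y ⟨
    f b               ∎
    where open ≡-Reasoning
  ... | no z≢a with z ≟ b
  ...   | yes refl = begin
    f' b              ≡⟨ e b ⟩
    swap x y (f b)    ≡⟨ cong (swap x y) fb≡y ⟩
    swap x y y        ≡⟨ swap-y x y ⟩
    x                 ≡⟨ fa≡x ⟨
    f a               ∎
    where open ≡-Reasoning
  ...   | no z≢b = trans (e z)
    (swap-other x y (f z) (λ fz≡x → z≢a (f-inj (trans fz≡x (sym fa≡x))))
                          (λ fz≡y → z≢b (f-inj (trans fz≡y (sym fb≡y)))))

  left-split-count : ∀ {f f' x y k k'} → Inj f → Inj f' → LeftSwap f f' x y → SameOrbit f x y → x ≢ y →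
                     NumOrbits f k → NumOrbits f' k' → k' ≡ suc k
  left-split-count {f} {x = x} {y} f-inj f'-inj e x~y x≢y with preimage f f-inj x | preimage f f-inj y
  ... | a , fa≡x | b , fb≡y = split-count f-inj f'-inj (left⇒right f-inj e fa≡x fb≡y) a~b a≢b
    where
    a~b : SameOrbit f a b
    a~b = orbit-trans f (1 , fa≡x) (orbit-trans f x~y (orbit-sym f f-inj (1 , fb≡y)))
    a≢b : a ≢ b
    a≢b a≡b = x≢y (trans (sym fa≡x) (trans (cong f a≡b) fb≡y))

  left-join-count : ∀ {f f' x y k k'} → Inj f → Inj f' → LeftSwap f f' x y → ¬ SameOrbit f x y →
                    NumOrbits f k → NumOrbits f' k' → k ≡ suc k'
  left-join-count {f} {x = x} {y} f-inj f'-inj e x≁y with preimage f f-inj x | preimage f f-inj y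
  ... | a , fa≡x | b , fb≡y = join-count f-inj f'-inj (left⇒right f-inj e fa≡x fb≡y) a≁b
    where
    a≁b : ¬ SameOrbit f a b
    a≁b a~b = x≁y (orbit-trans f (orbit-sym f f-inj (1 , fa≡x)) (orbit-trans f a~b (1 , fb≡y)))

  -- Proved by induction on |C| − #f: for a point x moved by f, the
  -- permutation f ∘ (x fx) has one more cycle, while #(f⁻¹g) and #⟨f,g⟩
  -- change compatibly ('GenusStep').

  -- Base case: f is the identity, so f⁻¹g = g and ⟨f, g⟩ = ⟨g⟩.
  genus-identity : (f : Perm C) (g h : C → C) → Inj g → (∀ z → h z ≡ inv f (g z)) → (∀ z → fun f z ≡ z) →
                   ∀ {a b c d} → NumOrbits (fun f) a → NumOrbits h b → NumOrbits g c → NumOrbits₂ (fun f) g d →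
                   a + b + c ≤ N + 2 * d
  genus-identity f g h g-inj h≗ f≗id {a} {b} {c} {d} ca cb cc cd = begin
    a + b + c  ≡⟨ cong (λ t → a + t + c) b≡c ⟩
    a + c + c  ≡⟨ double a c ⟩
    a + 2 * c  ≤⟨ ℕₚ.+-monoˡ-≤ (2 * c) (classes≤size ca) ⟩
    N + 2 * c  ≡⟨ cong (λ t → N + 2 * t) d≡c ⟨
    N + 2 * d  ∎
    where
    open ℕₚ.≤-Reasoning
    double : ∀ a c → a + c + c ≡ a + 2 * c
    double = solve-∀
    h≗g : ∀ z → h z ≡ g z
    h≗g z = trans (h≗ z) (trans (sym (f≗id (inv f (g z)))) (inv-r f (g z)))
    b≡c : b ≡ c
    b≡c = classes-unique (orbit-cong h≗g) (orbit-cong (sym ∘ h≗g)) cb cc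
    d≡c : d ≡ c
    d≡c = classes-unique
      (reach-least (orbit-isEquivalence g g-inj) (fun f) g (λ z → subst (SameOrbit g z) (sym (f≗id z)) (orbit-refl g z)) (orbit-step g))
      (orbit-least (reach-isEquivalence (fun f) g (perm-injective f) g-inj) g (λ z → stepg here)) cd cc

  -- The induction step at a point x moved by f, with f₀ = f ∘ (x fx) and
  -- h₀ = f₀⁻¹ g = (x fx) ∘ h.
  module GenusStep (f : Perm C) (g h : C → C) (g-inj : Inj g) (h≗ : ∀ z → h z ≡ inv f (g z))
                   (x : C) (moved : fun f x ≢ x) where
    y : C
    y = fun f x

    f₀ : Perm C
    f₀ = swapped f x y

    h₀ : C → C
    h₀ = swap x y ∘ h

    h₀≗ : ∀ z → h₀ z ≡ inv f₀ (g z)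
    h₀≗ z = cong (swap x y) (h≗ z)

    f-inj : Inj (fun f)
    f-inj = perm-injective f

    f₀-inj : Inj (fun f₀)
    f₀-inj = perm-injective f₀

    h-inj : Inj h
    h-inj {u} {v} e = g-inj (begin
      g u                 ≡⟨ inv-r f (g u) ⟨
      fun f (inv f (g u)) ≡⟨ cong (fun f) (trans (sym (h≗ u)) (trans e (h≗ v))) ⟩
      fun f (inv f (g v)) ≡⟨ inv-r f (g v) ⟩
      g v                 ∎)
      where open ≡-Reasoning

    h₀-inj : Inj h₀
    h₀-inj = h-inj ∘ swap-injective x y

    h-from-h₀ : LeftSwap h₀ h x y
    h-from-h₀ z = sym (swap-involutive x y (h z))

    f-swap : RightSwap (fun f) (fun f₀) x y
    f-swap _ = refl

    f₀-swap : RightSwap (fun f₀) (fun f) x y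
    f₀-swap = right-swap-sym f-swap

    f₀-count : ∀ {a a₀} → NumOrbits (fun f) a → NumOrbits (fun f₀) a₀ → a₀ ≡ suc a
    f₀-count = split-count f-inj f₀-inj f-swap (orbit-step (fun f) x) (moved ∘ sym)

    R₀ : C → C → Set
    R₀ = Reach₂ (fun f₀) g

    R₀-isEq : IsEquivalence R₀
    R₀-isEq = reach-isEquivalence (fun f₀) g f₀-inj g-inj

    -- f differs from f₀ only at x and y, so ⟨f, g⟩ ⊆ ⟨f₀, g⟩ up to x ~ y
    reach-linked : ∀ {u v} → Reach₂ (fun f) g u v → Linked R₀ x y u v
    reach-linked = reach-least (linked-isEquivalence R₀-isEq) (fun f) g f-step (λ z → inj₁ (stepg here))
      where
      fx≡f₀y : fun f x ≡ fun f₀ y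
      fx≡f₀y = right-at-a {f = fun f₀} {f' = fun f} f₀-swap
      fy≡f₀x : fun f y ≡ fun f₀ x
      fy≡f₀x = right-at-b {f = fun f₀} {f' = fun f} f₀-swap
      f-step : ∀ z → Linked R₀ x y z (fun f z)
      f-step z with z ≟ x
      ... | yes refl = inj₂ (inj₁ (here , subst (R₀ y) (sym fx≡f₀y) (stepf here)))
      ... | no z≢x with z ≟ y
      ...   | yes refl = inj₂ (inj₂ (here , subst (R₀ x) (sym fy≡f₀x) (stepf here)))
      ...   | no z≢y   = inj₁ (subst (R₀ z) (sym (right-elsewhere {f = fun f₀} {f' = fun f} f₀-swap z z≢x z≢y)) (stepf here))

    h₀-within : ∀ {u v} → SameOrbit h₀ u v → R₀ u v
    h₀-within = orbit-least R₀-isEq h₀ λ z →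
      subst (R₀ z) (sym (h₀≗ z)) (reach-trans (stepg here) (back (g z)))
      where
      back : ∀ v → R₀ v (inv f₀ v)
      back v = IsEquivalence.sym R₀-isEq (subst (R₀ (inv f₀ v)) (inv-r f₀ v) (stepf here))

    shift : ∀ a b c → a + suc b + c ≡ suc a + b + c
    shift = solve-∀

    -- x, y on one cycle of f₀⁻¹ g: that cycle is cut in f⁻¹ g, and ⟨f₀, g⟩ ⊇ ⟨f, g⟩.
    step-cut : ∀ {a b c d a₀ b₀ d₀} → NumOrbits (fun f) a → NumOrbits h b → NumOrbits₂ (fun f) g d →
               NumOrbits (fun f₀) a₀ → NumOrbits h₀ b₀ → NumOrbits₂ (fun f₀) g d₀ → SameOrbit h₀ x y →
               a₀ + b₀ + c ≤ N + 2 * d₀ → a + b + c ≤ N + 2 * d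
    step-cut {a} {b} {c} {d} {a₀} {b₀} {d₀} ca cb cd ca₀ cb₀ cd₀ x~y IH = begin
      a + b + c       ≡⟨ cong (λ t → a + t + c) (left-split-count h₀-inj h-inj h-from-h₀ x~y (moved ∘ sym) cb₀ cb) ⟩
      a + suc b₀ + c  ≡⟨ shift a b₀ c ⟩
      suc a + b₀ + c  ≡⟨ cong (λ t → t + b₀ + c) (f₀-count ca ca₀) ⟨
      a₀ + b₀ + c     ≤⟨ IH ⟩
      N + 2 * d₀      ≤⟨ ℕₚ.+-monoʳ-≤ N (ℕₚ.*-monoʳ-≤ 2 d₀≤d) ⟩
      N + 2 * d       ∎
      where
      open ℕₚ.≤-Reasoning
      d₀≤d : d₀ ≤ d
      d₀≤d = classes-antitone (linked-collapse R₀-isEq (h₀-within x~y) ∘ reach-linked) cd cd₀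

    cancel-two : ∀ a b c d → suc a + suc b + c ≤ N + 2 * suc d → a + b + c ≤ N + 2 * d
    cancel-two a b c d le = ℕₚ.≤-pred (ℕₚ.≤-pred (subst₂ _≤_ (lhs a b c) (rhs N d) le))
      where
      lhs : ∀ a b c → suc a + suc b + c ≡ 2 + (a + b + c)
      lhs = solve-∀
      rhs : ∀ N d → N + 2 * suc d ≡ 2 + (N + 2 * d)
      rhs = solve-∀

    -- x, y on different cycles of f₀⁻¹ g: they are joined in f⁻¹ g, and
    -- ⟨f, g⟩ has at most one orbit fewer than ⟨f₀, g⟩.
    step-join : ∀ {a b c d a₀ b₀ d₀} → NumOrbits (fun f) a → NumOrbits h b → NumOrbits₂ (fun f) g d →
                NumOrbits (fun f₀) a₀ → NumOrbits h₀ b₀ → NumOrbits₂ (fun f₀) g d₀ → ¬ SameOrbit h₀ x y →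
                a₀ + b₀ + c ≤ N + 2 * d₀ → a + b + c ≤ N + 2 * d
    step-join {a} {b} {c} {d} {a₀} {b₀} {d₀} ca cb cd ca₀ cb₀ cd₀ x≁y IH = cancel-two a b c d (begin
      suc a + suc b + c  ≡⟨ cong₂ (λ s t → s + t + c) (f₀-count ca ca₀)
                                   (left-join-count h₀-inj h-inj h-from-h₀ x≁y cb₀ cb) ⟨
      a₀ + b₀ + c        ≤⟨ IH ⟩
      N + 2 * d₀         ≤⟨ ℕₚ.+-monoʳ-≤ N (ℕₚ.*-monoʳ-≤ 2 (classes-linked-≤ reach-linked cd₀ cd)) ⟩
      N + 2 * suc d      ∎)
      where open ℕₚ.≤-Reasoning

    fewer-cycles : ∀ {a} → NumOrbits (fun f) a → a < N
    fewer-cycles ca with orbits-exist (fun f₀) f₀-inj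
    ... | _ , ca₀ = subst (_≤ N) (f₀-count ca ca₀) (classes≤size ca₀)

    step : ∀ {a b c d} → NumOrbits (fun f) a → NumOrbits h b → NumOrbits₂ (fun f) g d →
           (∀ {a₀ b₀ d₀} → a₀ ≡ suc a → NumOrbits (fun f₀) a₀ → NumOrbits h₀ b₀ → NumOrbits₂ (fun f₀) g d₀ →
             a₀ + b₀ + c ≤ N + 2 * d₀) →
           a + b + c ≤ N + 2 * d
    step ca cb cd IH with orbits-exist (fun f₀) f₀-inj | orbits-exist h₀ h₀-inj | orbits₂-exist (fun f₀) g f₀-inj g-inj
    ... | _ , ca₀ | _ , cb₀ | _ , cd₀ with classes-decidable cb₀ x y
    ...   | yes x~y = step-cut  ca cb cd ca₀ cb₀ cd₀ x~y (IH (f₀-count ca ca₀) ca₀ cb₀ cd₀)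
    ...   | no x≁y  = step-join ca cb cd ca₀ cb₀ cd₀ x≁y (IH (f₀-count ca ca₀) ca₀ cb₀ cd₀)

  fixed-or-moved : (f : C → C) → (∀ z → f z ≡ z) ⊎ (∃ λ x → f x ≢ x)
  fixed-or-moved f with Finₚ.any? (λ j → ¬? (f (from j) ≟ from j))
  ... | yes (j , moved) = inj₂ (from j , moved)
  ... | no none         = inj₁ fixed
    where
    fixed : ∀ z → f z ≡ z
    fixed z with f z ≟ z
    ... | yes fz≡z = fz≡z
    ... | no fz≢z  = ⊥-elim (none (to z , subst (λ v → f v ≢ v) (sym (strictlyInverseʳ z)) fz≢z))

  genus-by-deficit : ∀ m (f : Perm C) (g h : C → C) → Inj g → (∀ z → h z ≡ inv f (g z)) →
                     ∀ {a b c d} → m + a ≡ N → NumOrbits (fun f) a → NumOrbits h b → NumOrbits g c →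
                     NumOrbits₂ (fun f) g d → a + b + c ≤ N + 2 * d
  genus-by-deficit m f g h g-inj h≗ m+a≡N ca cb cc cd with fixed-or-moved (fun f)
  ... | inj₁ f≗id = genus-identity f g h g-inj h≗ f≗id ca cb cc cd
  genus-by-deficit zero f g h g-inj h≗ a≡N ca cb cc cd | inj₂ (x , moved) =
    ⊥-elim (ℕₚ.<-irrefl a≡N (GenusStep.fewer-cycles f g h g-inj h≗ x moved ca))
  genus-by-deficit (suc m) f g h g-inj h≗ {a} 1+m+a≡N ca cb cc cd | inj₂ (x , moved) =
    S.step ca cb cd λ a₀≡1+a ca₀ cb₀ cd₀ →
      genus-by-deficit m S.f₀ g S.h₀ g-inj S.h₀≗ (trans (cong (m +_) a₀≡1+a) (trans (ℕₚ.+-suc m a) 1+m+a≡N))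
                       ca₀ cb₀ cc cd₀
    where module S = GenusStep f g h g-inj h≗ x moved

  genus-inequality : (f : Perm C) (g h : C → C) → Inj g → (∀ z → h z ≡ inv f (g z)) →
                     ∀ {a b c d} → NumOrbits (fun f) a → NumOrbits h b → NumOrbits g c →
                     NumOrbits₂ (fun f) g d → a + b + c ≤ N + 2 * d
  genus-inequality f g h g-inj h≗ ca = genus-by-deficit _ f g h g-inj h≗ (ℕₚ.m∸n+n≡m (classes≤size ca)) ca

signed-enum : ∀ {n} → SignedSet n ↔ Fin (n * 2)
signed-enum {n} = ↔-sym Finₚ.*↔× ↔-∘ (↔-id (Fin n) ×-↔ ↔-sym Finₚ.2↔Bool)

module Signed (n : ℕ) = Finite (signed-enum {n})

neg-involutive : ∀ {n} (x : SignedSet n) → neg (neg x) ≡ x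
neg-involutive (i , s) = cong (i ,_) (Boolₚ.not-involutive s)

neg-injective : ∀ {n} → Inj (neg {n})
neg-injective {x = x} {y} e = trans (sym (neg-involutive x)) (trans (cong neg e) (neg-involutive y))

neg-distinct : ∀ {n} (x : SignedSet n) → x ≢ neg x
neg-distinct (i , true)  ()
neg-distinct (i , false) ()

cyc-last : ∀ m (i : Fin (suc m)) s → m ≡ toℕ i → cyc (suc m) (i , s) ≡ (Fin.zero , not s)
cyc-last m i s m≡i with m ℕₚ.≟ toℕ i
... | yes _  = refl
... | no m≢i = ⊥-elim (m≢i m≡i)

cyc-mid : ∀ m (i : Fin (suc m)) s (m≢i : m ≢ toℕ i) → cyc (suc m) (i , s) ≡ (Fin.suc (Fin.lower₁ i m≢i) , s)
cyc-mid m i s m≢i with m ℕₚ.≟ toℕ i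
... | yes m≡i  = ⊥-elim (m≢i m≡i)
... | no m≢i′ = cong (λ j → Fin.suc j , s) (Finₚ.lower₁-irrelevant i m≢i′ m≢i)

cyc-neg : ∀ m (x : SignedSet m) → cyc m (neg x) ≡ neg (cyc m x)
cyc-neg (suc m) (i , s) with m ℕₚ.≟ toℕ i
... | yes _ = refl
... | no _  = refl

cyc-injective : ∀ m → Inj (cyc m)
cyc-injective (suc m) {i , s} {i′ , s′} e with m ℕₚ.≟ toℕ i | m ℕₚ.≟ toℕ i′
... | yes m≡i | yes m≡i′ = cong₂ _,_ (Finₚ.toℕ-injective (trans (sym m≡i) m≡i′)) (Boolₚ.not-injective (cong proj₂ e))
... | no _    | no _     = cong₂ _,_ (Finₚ.lower₁-injective (Finₚ.suc-injective (cong proj₁ e))) (cong proj₂ e)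
... | yes _   | no _     with () ← cong proj₁ e
... | no _    | yes _    with () ← cong proj₁ e

-- The cycle is a single orbit: from (0, s) it runs through all (i, s), and
-- after (m-1, s) it continues with (0, ¬s).
cycle-connected : ∀ m (x y : SignedSet m) → SameOrbit (cyc m) x y
cycle-connected (suc m) (i , s) (i′ , s′) =
  orbit-trans f (orbit-sym f (cyc-injective (suc m)) (from-zero i s))
    (orbit-trans f (zero-to-zero s s′) (from-zero i′ s′))
  where
  open Signed (suc m) using (orbit-sym)
  f : SignedSet (suc m) → SignedSet (suc m)
  f = cyc (suc m)
  climb : ∀ k (k<1+m : k < suc m) s → SameOrbit f (Fin.zero , s) (Fin.fromℕ< k<1+m , s)
  climb zero    _     s = orbit-refl f _
  climb (suc k) k+1<1+m s = orbit-trans f (climb k k<1+m s) (1 , trans (cyc-mid m _ s m≢k) (cong (_, s) (Finₚ.toℕ-injective k+1)))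
    where
    k<1+m : k < suc m
    k<1+m = ℕₚ.<-trans (ℕₚ.n<1+n k) k+1<1+m
    m≢k : m ≢ toℕ (Fin.fromℕ< k<1+m)
    m≢k e = ℕₚ.<-irrefl (trans (sym (Finₚ.toℕ-fromℕ< k<1+m)) (sym e)) (ℕₚ.≤-pred k+1<1+m)
    k+1 : toℕ (Fin.suc (Fin.lower₁ (Fin.fromℕ< k<1+m) m≢k)) ≡ toℕ (Fin.fromℕ< k+1<1+m)
    k+1 = trans (cong suc (trans (Finₚ.toℕ-lower₁ _ m≢k) (Finₚ.toℕ-fromℕ< k<1+m))) (sym (Finₚ.toℕ-fromℕ< k+1<1+m))
  from-zero : ∀ i s → SameOrbit f (Fin.zero , s) (i , s)
  from-zero i s = subst (λ j → SameOrbit f (Fin.zero , s) (j , s)) (Finₚ.fromℕ<-toℕ i (Finₚ.toℕ<n i))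
                        (climb (toℕ i) (Finₚ.toℕ<n i) s)
  flip : ∀ s → SameOrbit f (Fin.zero , s) (Fin.zero , not s)
  flip s = orbit-trans f (from-zero (Fin.fromℕ m) s) (1 , cyc-last m (Fin.fromℕ m) s (sym (Finₚ.toℕ-fromℕ m)))
  zero-to-zero : ∀ s s′ → SameOrbit f (Fin.zero , s) (Fin.zero , s′)
  zero-to-zero true  true  = orbit-refl f _
  zero-to-zero false false = orbit-refl f _
  zero-to-zero true  false = flip true
  zero-to-zero false true  = flip false

module Gamma (p q : ℕ) where
  X : Set
  X = SignedSet (p + q)

  γ : X → X
  γ = gamma p q

  left : SignedSet p → X
  left (j , s) = j ↑ˡ q , s

  right : SignedSet q → X
  right (j , s) = p ↑ʳ j , s

  γ-left : ∀ y → γ (left y) ≡ left (cyc p y)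
  γ-left (j , s) rewrite Finₚ.splitAt-↑ˡ p j q = refl

  γ-right : ∀ y → γ (right y) ≡ right (cyc q y)
  γ-right (j , s) rewrite Finₚ.splitAt-↑ʳ p q j = refl

  left-or-right : ∀ x → (∃ λ y → x ≡ left y) ⊎ (∃ λ y → x ≡ right y)
  left-or-right (i , s) with Fin.splitAt p i | Finₚ.join-splitAt p q i
  ... | inj₁ j | e = inj₁ ((j , s) , cong (_, s) (sym e))
  ... | inj₂ j | e = inj₂ ((j , s) , cong (_, s) (sym e))

  left-injective : ∀ {y y′} → left y ≡ left y′ → y ≡ y′
  left-injective {j , _} {j′ , _} e = cong₂ _,_ (Finₚ.↑ˡ-injective q j j′ (cong proj₁ e)) (cong proj₂ e)

  right-injective : ∀ {y y′} → right y ≡ right y′ → y ≡ y′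
  right-injective {j , _} {j′ , _} e = cong₂ _,_ (Finₚ.↑ʳ-injective p j j′ (cong proj₁ e)) (cong proj₂ e)

  left≢right : ∀ y y′ → left y ≢ right y′
  left≢right (j , _) (j′ , _) e
    with () ← trans (sym (Finₚ.splitAt-↑ˡ p j q)) (trans (cong (Fin.splitAt p ∘ proj₁) e) (Finₚ.splitAt-↑ʳ p q j′))

  γ-injective : Inj γ
  γ-injective {x} {x′} e with left-or-right x | left-or-right x′
  ... | inj₁ (y , refl) | inj₁ (y′ , refl) =
    cong left (cyc-injective p (left-injective (trans (sym (γ-left y)) (trans e (γ-left y′)))))
  ... | inj₂ (y , refl) | inj₂ (y′ , refl) =
    cong right (cyc-injective q (right-injective (trans (sym (γ-right y)) (trans e (γ-right y′)))))
  ... | inj₁ (y , refl) | inj₂ (y′ , refl) = ⊥-elim (left≢right _ _ (trans (sym (γ-left y)) (trans e (γ-right y′))))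
  ... | inj₂ (y , refl) | inj₁ (y′ , refl) = ⊥-elim (left≢right _ _ (trans (sym (γ-left y′)) (trans (sym e) (γ-right y))))

  γ-neg : ∀ x → γ (neg x) ≡ neg (γ x)
  γ-neg x with left-or-right x
  ... | inj₁ ((j , s) , refl) = trans (γ-left (j , not s)) (trans (cong left (cyc-neg p (j , s))) (cong neg (sym (γ-left (j , s)))))
  ... | inj₂ ((j , s) , refl) = trans (γ-right (j , not s)) (trans (cong right (cyc-neg q (j , s))) (cong neg (sym (γ-right (j , s)))))

  Y-left : ∀ y → InY p q (left y)
  Y-left (j , _) = j , Finₚ.splitAt-↑ˡ p j q

  Z-right : ∀ y → InZ p q (right y)
  Z-right (j , _) = j , Finₚ.splitAt-↑ʳ p q j

  Y-or-Z : ∀ x → InY p q x ⊎ InZ p q x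
  Y-or-Z x with left-or-right x
  ... | inj₁ (y , refl) = inj₁ (Y-left y)
  ... | inj₂ (y , refl) = inj₂ (Z-right y)

  Y-disjoint-Z : ∀ x → InY p q x → ¬ InZ p q x
  Y-disjoint-Z (i , _) (_ , eY) (_ , eZ) with () ← trans (sym eY) eZ

  Y-is-left : ∀ x → InY p q x → ∃ λ y → x ≡ left y
  Y-is-left x x∈Y with left-or-right x
  ... | inj₁ r = r
  ... | inj₂ (y , refl) = ⊥-elim (Y-disjoint-Z (right y) x∈Y (Z-right y))

  Z-is-right : ∀ x → InZ p q x → ∃ λ y → x ≡ right y
  Z-is-right x x∈Z with left-or-right x
  ... | inj₂ r = r
  ... | inj₁ (y , refl) = ⊥-elim (Y-disjoint-Z (left y) (Y-left y) x∈Z)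

  record Block (B : X → Set) : Set where
    field
      γ-closed   : ∀ x → B x → B (γ x)
      neg-closed : ∀ x → B x → B (neg x)
      transitive : ∀ x x′ → B x → B x′ → SameOrbit γ x x′

  Y-block : Block (InY p q)
  Y-block = record
    { γ-closed   = λ x x∈Y → γ-closed′ x (Y-is-left x x∈Y)
    ; neg-closed = λ _ x∈Y → x∈Y
    ; transitive = λ x x′ x∈Y x′∈Y → transitive′ (Y-is-left x x∈Y) (Y-is-left x′ x′∈Y)
    }
    where
    γ-closed′ : ∀ x → (∃ λ y → x ≡ left y) → InY p q (γ x)
    γ-closed′ _ (y , refl) = subst (InY p q) (sym (γ-left y)) (Y-left (cyc p y))
    transitive′ : ∀ {x x′} → (∃ λ y → x ≡ left y) → (∃ λ y → x′ ≡ left y) → SameOrbit γ x x′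
    transitive′ (y , refl) (y′ , refl) with cycle-connected p y y′
    ... | k , e = k , trans (iter-left k y) (cong left e)
      where
      iter-left : ∀ k y → iter γ k (left y) ≡ left (iter (cyc p) k y)
      iter-left zero    y = refl
      iter-left (suc k) y = trans (cong γ (iter-left k y)) (γ-left _)

  Z-block : Block (InZ p q)
  Z-block = record
    { γ-closed   = λ x x∈Z → γ-closed′ x (Z-is-right x x∈Z)
    ; neg-closed = λ _ x∈Z → x∈Z
    ; transitive = λ x x′ x∈Z x′∈Z → transitive′ (Z-is-right x x∈Z) (Z-is-right x′ x′∈Z)
    }
    where
    γ-closed′ : ∀ x → (∃ λ y → x ≡ right y) → InZ p q (γ x)
    γ-closed′ _ (y , refl) = subst (InZ p q) (sym (γ-right y)) (Z-right (cyc q y))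
    transitive′ : ∀ {x x′} → (∃ λ y → x ≡ right y) → (∃ λ y → x′ ≡ right y) → SameOrbit γ x x′
    transitive′ (y , refl) (y′ , refl) with cycle-connected q y y′
    ... | k , e = k , trans (iter-right k y) (cong right e)
      where
      iter-right : ∀ k y → iter γ k (right y) ≡ right (iter (cyc q) k y)
      iter-right zero    y = refl
      iter-right (suc k) y = trans (cong γ (iter-right k y)) (γ-right _)

  γ-pairs : ∀ x → SameOrbit γ x (neg x)
  γ-pairs x with Y-or-Z x
  ... | inj₁ x∈Y = Block.transitive Y-block x (neg x) x∈Y x∈Y
  ... | inj₂ x∈Z = Block.transitive Z-block x (neg x) x∈Z x∈Z

module Surgery (p q : ℕ) (τ : Perm (SignedSet (p + q))) (τ-neg : InB τ) (u : SignedSet (p + q)) where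
  open Signed (p + q)
  open Gamma p q

  w : X
  w = fun τ u

  σ : Perm X
  σ = swapped τ u (neg u)

  γ̂ : X → X
  γ̂ = swap w (neg w) ∘ γ

  σ-inj : Inj (fun σ)
  σ-inj = perm-injective σ

  γ̂-inj : Inj γ̂
  γ̂-inj = γ-injective ∘ swap-injective w (neg w)

  same-product : ∀ z → inv τ (γ z) ≡ inv σ (γ̂ z)
  same-product z = begin
    inv τ (γ z)                                                   ≡⟨ swap-involutive u (neg u) _ ⟨
    swap u (neg u) (swap u (neg u) (inv τ (γ z)))                 ≡⟨ cong (swap u (neg u)) (swap-conjugate τ u (neg u) (γ z)) ⟨
    swap u (neg u) (inv τ (swap w (fun τ (neg u)) (γ z)))          ≡⟨ cong (λ v → swap u (neg u) (inv τ (swap w v (γ z)))) (τ-neg u) ⟩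
    inv σ (γ̂ z)                                                   ∎
    where open ≡-Reasoning

  σ-count : SameOrbit (fun τ) u (neg u) → ∀ {a a′} → NumOrbits (fun τ) a → NumOrbits (fun σ) a′ → a′ ≡ suc a
  σ-count u~-u = split-count (perm-injective τ) σ-inj (λ _ → refl) u~-u (neg-distinct u)

  γ̂-count : ∀ {c c′} → NumOrbits γ c → NumOrbits γ̂ c′ → c′ ≡ suc c
  γ̂-count = left-split-count γ-injective γ̂-inj (λ _ → refl) (γ-pairs w) (neg-distinct w)

  swap-neg : ∀ v z → swap v (neg v) (neg z) ≡ neg (swap v (neg v) z)
  swap-neg v z = begin
    swap v (neg v) (neg z)              ≡⟨ cong (λ t → swap t (neg v) (neg z)) (neg-involutive v) ⟨
    swap (neg (neg v)) (neg v) (neg z)  ≡⟨ swap-comm _ _ _ ⟨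
    swap (neg v) (neg (neg v)) (neg z)  ≡⟨ swap-natural neg neg-injective v (neg v) z ⟩
    neg (swap v (neg v) z)              ∎
    where open ≡-Reasoning

  σ-neg : ∀ z → fun σ (neg z) ≡ neg (fun σ z)
  σ-neg z = trans (cong (fun τ) (swap-neg u z)) (τ-neg _)

  γ̂-neg : ∀ z → γ̂ (neg z) ≡ neg (γ̂ z)
  γ̂-neg z = trans (cong (swap w (neg w)) (γ-neg z)) (swap-neg w (γ z))

  infix 4 _∼_
  _∼_ : X → X → Set
  _∼_ = Reach₂ (fun σ) γ̂

  ∼-isEquivalence : IsEquivalence _∼_
  ∼-isEquivalence = reach-isEquivalence (fun σ) γ̂ σ-inj γ̂-inj

  open IsEquivalence ∼-isEquivalence using () renaming (sym to ∼-sym; trans to ∼-trans)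

  ∼-neg : ∀ {x y} → x ∼ y → neg x ∼ neg y
  ∼-neg here              = here
  ∼-neg (stepf {y = y} r) = subst (_ ∼_) (σ-neg y) (stepf (∼-neg r))
  ∼-neg (stepg {y = y} r) = subst (_ ∼_) (γ̂-neg y) (stepg (∼-neg r))

  ∼-neg′ : ∀ {x y} → neg x ∼ y → x ∼ neg y
  ∼-neg′ r = subst (_∼ _) (neg-involutive _) (∼-neg r)

  Paired : X → Set
  Paired z = z ∼ neg z

  paired-resp : ∀ {x y} → x ∼ y → Paired x → Paired y
  paired-resp r x-paired = ∼-trans (∼-sym r) (∼-trans x-paired (∼-neg r))

  σ-u : u ∼ neg w
  σ-u = subst (u ∼_) (trans (cong (fun τ) (swap-x u (neg u))) (τ-neg u)) (stepf here)

  σ-neg-u : neg u ∼ w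
  σ-neg-u = subst (neg u ∼_) (cong (fun τ) (swap-y u (neg u))) (stepf here)

  w-paired⇒u-paired : Paired w → Paired u
  w-paired⇒u-paired w-paired = ∼-trans σ-u (∼-trans (∼-sym w-paired) (∼-sym σ-neg-u))

  _≈_ : X → X → Set
  _≈_ = Linked _∼_ u (neg u)

  ≈-isEquivalence : IsEquivalence _≈_
  ≈-isEquivalence = linked-isEquivalence ∼-isEquivalence

  τ-step : ∀ z → z ≈ fun τ z
  τ-step z with z ≟ u
  ... | yes refl = inj₂ (inj₁ (here , σ-neg-u))
  ... | no z≢u with z ≟ neg u
  ...   | yes refl = inj₂ (inj₂ (here , subst (u ∼_) (sym (τ-neg u)) σ-u))
  ...   | no z≢-u  = inj₁ (subst (z ∼_) (right-elsewhere {f = fun τ} {f' = fun σ} (λ _ → refl) z z≢u z≢-u) (stepf here))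

  γ-step : ∀ z → z ≈ γ z
  γ-step z with γ z ≟ w
  ... | yes γz≡w = inj₂ (inj₁ (∼-trans (subst (z ∼_) γ̂z≡-w (stepg here)) (∼-sym σ-u) , subst (neg u ∼_) (sym γz≡w) σ-neg-u))
    where
    γ̂z≡-w : γ̂ z ≡ neg w
    γ̂z≡-w = trans (cong (swap w (neg w)) γz≡w) (swap-x w (neg w))
  ... | no γz≢w with γ z ≟ neg w
  ...   | yes γz≡-w = inj₂ (inj₂ (∼-trans (subst (z ∼_) γ̂z≡w (stepg here)) (∼-sym σ-neg-u) , subst (u ∼_) (sym γz≡-w) σ-u))
    where
    γ̂z≡w : γ̂ z ≡ w
    γ̂z≡w = trans (cong (swap w (neg w)) γz≡-w) (swap-y w (neg w))
  ...   | no γz≢-w  = inj₁ (subst (z ∼_) (swap-other w (neg w) (γ z) γz≢w γz≢-w) (stepg here))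

  reach-linked : ∀ {x y} → Reach₂ (fun τ) γ x y → x ≈ y
  reach-linked = reach-least ≈-isEquivalence (fun τ) γ τ-step γ-step

  γ-orbit-linked : ∀ {x y} → SameOrbit γ x y → x ≈ y
  γ-orbit-linked = orbit-least ≈-isEquivalence γ γ-step

  paired-transfer : ∀ {x y} → x ≈ y → Paired y → Paired x ⊎ Paired u
  paired-transfer (inj₁ x∼y)               y-paired = inj₁ (paired-resp (∼-sym x∼y) y-paired)
  paired-transfer (inj₂ (inj₁ (_ , -u∼y))) y-paired =
    inj₂ (∼-trans (∼-neg′ -u∼y) (∼-trans (∼-sym y-paired) (∼-sym -u∼y)))
  paired-transfer (inj₂ (inj₂ (_ , u∼y)))  y-paired =
    inj₂ (∼-trans u∼y (∼-trans y-paired (∼-sym (∼-neg u∼y))))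

  -- In a block avoiding w (hence also -w), γ̂ agrees with γ, so every
  -- point of the block is paired.
  block-paired : ∀ {B} → Block B → ¬ B w → ∀ z → B z → Paired z
  block-paired {B} blk w∉B z z∈B with Block.transitive blk z (neg z) z∈B (Block.neg-closed blk z z∈B)
  ... | k , e = subst (z ∼_) e (proj₂ (walk k))
    where
    -w∉B : ¬ B (neg w)
    -w∉B -w∈B = w∉B (subst B (neg-involutive w) (Block.neg-closed blk _ -w∈B))
    walk : ∀ k → B (iter γ k z) × z ∼ iter γ k z
    walk zero = z∈B , here
    walk (suc k) with walk k
    ... | v∈B , z∼v = γv∈B , subst (z ∼_) γ̂v≡γv (stepg z∼v)
      where
      γv∈B : B (γ (iter γ k z))
      γv∈B = Block.γ-closed blk _ v∈B
      γ̂v≡γv : γ̂ (iter γ k z) ≡ γ (iter γ k z)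
      γ̂v≡γv = swap-other w (neg w) _ (λ e → w∉B (subst B e γv∈B)) (λ e → -w∉B (subst B e γv∈B))

  -- If a τ-cycle meets both blocks, u is paired: one block avoids w and
  -- is paired throughout; the other contains w and is γ-connected to it.
  paired-via-blocks : ∀ {B B′} → Block B → Block B′ → B w → ¬ B′ w →
                      ∀ x x′ → B x → B′ x′ → x ≈ x′ → Paired u
  paired-via-blocks blk blk′ w∈B w∉B′ x x′ x∈B x′∈B′ x≈x′
    with paired-transfer x≈x′ (block-paired blk′ w∉B′ x′ x′∈B′)
  ... | inj₂ u-paired = u-paired
  ... | inj₁ x-paired with paired-transfer (γ-orbit-linked (Block.transitive blk w x w∈B x∈B)) x-paired
  ...   | inj₁ w-paired = w-paired⇒u-paired w-paired
  ...   | inj₂ u-paired = u-paired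

  u-paired : GammaConnected p q τ → Paired u
  u-paired (x , y , x∈Y , y∈Z , x~y) = by-block (Y-or-Z w)
    where
    x≈y : x ≈ y
    x≈y = orbit-least ≈-isEquivalence (fun τ) τ-step x~y
    by-block : InY p q w ⊎ InZ p q w → Paired u
    by-block (inj₁ w∈Y) = paired-via-blocks Y-block Z-block w∈Y (Y-disjoint-Z w w∈Y) x y x∈Y y∈Z x≈y
    by-block (inj₂ w∈Z) = paired-via-blocks Z-block Y-block w∈Z (λ w∈Y → Y-disjoint-Z w w∈Y w∈Z) y x y∈Z x∈Y
                            (IsEquivalence.sym ≈-isEquivalence x≈y)

  orbits₂-coarser : GammaConnected p q τ → ∀ {d d′} → NumOrbits₂ (fun τ) γ d → NumOrbits₂ (fun σ) γ̂ d′ → d′ ≤ d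
  orbits₂-coarser connected =
    classes-antitone (linked-collapse ∼-isEquivalence (u-paired connected) ∘ reach-linked)

  surgery-bound : GammaConnected p q τ → SameOrbit (fun τ) u (neg u) →
                  ∀ {a b c d} → NumOrbits (fun τ) a → NumOrbits (λ x → inv τ (γ x)) b → NumOrbits γ c →
                  NumOrbits₂ (fun τ) γ d → ∃ λ d′ → d′ ≤ d × suc a + b + suc c ≤ (p + q) * 2 + 2 * d′
  surgery-bound connected u~-u {a} {b} {c} {d} ca cb cc cd = d′ , d′≤d , bound
    where
    σ-orbits : ∃ λ a′ → NumOrbits (fun σ) a′
    σ-orbits = orbits-exist (fun σ) σ-inj
    γ̂-orbits : ∃ λ c′ → NumOrbits γ̂ c′
    γ̂-orbits = orbits-exist γ̂ γ̂-inj
    σγ̂-orbits : ∃ λ d′ → NumOrbits₂ (fun σ) γ̂ d′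
    σγ̂-orbits = orbits₂-exist (fun σ) γ̂ σ-inj γ̂-inj
    d′ : ℕ
    d′ = proj₁ σγ̂-orbits
    d′≤d : d′ ≤ d
    d′≤d = orbits₂-coarser connected cd (proj₂ σγ̂-orbits)
    bound : suc a + b + suc c ≤ (p + q) * 2 + 2 * d′
    bound = subst₂ (λ s t → s + b + t ≤ (p + q) * 2 + 2 * d′)
                   (σ-count u~-u ca (proj₂ σ-orbits)) (γ̂-count cc (proj₂ γ̂-orbits))
                   (genus-inequality σ γ̂ (λ x → inv τ (γ x)) γ̂-inj same-product
                                     (proj₂ σ-orbits) cb (proj₂ γ̂-orbits) (proj₂ σγ̂-orbits))

no-room : ∀ a b c n d d′ → a + b + c ≡ 2 * n + 2 * d → d′ ≤ d → suc a + b + suc c ≤ n * 2 + 2 * d′ → ⊥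
no-room a b c n d d′ count d′≤d genus = ℕₚ.<-irrefl refl (ℕₚ.≤-trans (ℕₚ.n≤1+n _) (begin
  2 + (a + b + c)    ≡⟨ two-more a b c ⟩
  suc a + b + suc c  ≤⟨ genus ⟩
  n * 2 + 2 * d′     ≤⟨ ℕₚ.+-monoʳ-≤ (n * 2) (ℕₚ.*-monoʳ-≤ 2 d′≤d) ⟩
  n * 2 + 2 * d      ≡⟨ cong (_+ 2 * d) (ℕₚ.*-comm n 2) ⟩
  2 * n + 2 * d      ≡⟨ count ⟨
  a + b + c          ∎))
  where
  open ℕₚ.≤-Reasoning
  two-more : ∀ a b c → 2 + (a + b + c) ≡ suc a + b + suc c
  two-more = solve-∀

proposition3p4 : (p q : ℕ) → 1 ≤ p → 1 ≤ q →
    (τ : Perm (SignedSet (p + q))) →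
    InSBnc p q τ → GammaConnected p q τ →
    ∀ x → ¬ InversionInvariantOrbitOf τ x
proposition3p4 p q _ _ τ ((a , b , c , d , ca , cb , cc , cd , count) , τ-neg) connected u invariant =
  no-room a b c (p + q) d d′ count d′≤d genus
  where
  u~-u : SameOrbit (fun τ) u (neg u)
  u~-u = Equivalence.to (invariant u) (orbit-refl (fun τ) u)
  bound : ∃ λ d′ → d′ ≤ d × suc a + b + suc c ≤ (p + q) * 2 + 2 * d′
  bound = Surgery.surgery-bound p q τ τ-neg u connected u~-u ca cb cc cd
  d′ : ℕ
  d′ = proj₁ bound
  d′≤d : d′ ≤ d
  d′≤d = proj₁ (proj₂ bound)
  genus : suc a + b + suc c ≤ (p + q) * 2 + 2 * d′
  genus = proj₂ (proj₂ bound)
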